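{- Let $\ell,m$ be positive integers, and let $t:[\ell]\times[\ell+m-1]\to[\ell]$ be defined by $t(r,s)=s$ if $s<r$, $t(r,s)=r$ if $r\leq s\leq m+r-1$, and $t(r,s)=s-m+1$ if $s>m+r-1$. For $\mu\in\mathcal{P}^{\ell,\ell+m-1}$ let $\tilde\mu:[\ell]\to[\ell]$ be $\tilde\mu(i)=t(i,\mu(i))$. Then: (a) $t(r,s)<r$ if and only if $s<r$, and $t(r,s)>r$ if and only if $s>r+m-1$; (b) $t(\gamma_\ell(r),\gamma_{\ell+m-1}(s))=\gamma_\ell(t(r,s))$ for all $(r,s)\in[\ell]\times[\ell+m-1]$; (c) for $\mu\in\mathcal{P}^{\ell,\ell+m-1}$ and $\mu'=\tau_{\ell+m-1}(\mu)$, $\gamma_\ell\circ\widetilde{\mu'}=\tilde\mu\circ\gamma_\ell$.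
   Context: $[n]=\{1,\dots,n\}$; $\gamma_n:[n]\to[n]$ is $i\mapsto n+1-i$. A partition with $n$ parts is a weakly decreasing sequence of $n$ positive integers, identified with the function $[n]\to\mathbb{Z}^+$, $i\mapsto\lambda_i$. $\mathcal{P}^{n,k}$ is the set of partitions with exactly $n$ parts all at most $k$. $\tau_k:\mathcal{P}^{n,k}\to\mathcal{P}^{n,k}$ is $\tau_k(\lambda_1,\dots,\lambda_n)=(k+1-\lambda_n,\dots,k+1-\lambda_1)$, i.e. $\tau_k(\lambda)=\gamma_k\circ\lambda\circ\gamma_n$. -}

module Defs where

open import Data.Nat using (ℕ; zero; suc; _+_; _∸_; _≤_; _<_)
open import Data.Nat.Properties using (_<?_; _≤?_)
open import Data.Product using (_×_)
open import Relation.Nullary using (yes; no)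

_∈[_] : ℕ → ℕ → Set
i ∈[ n ] = (1 ≤ i) × (i ≤ n)

γ : ℕ → ℕ → ℕ
γ n i = suc n ∸ i

-- A partition with exactly n parts, all at most k, viewed as a function
-- [n] → ℤ⁺ (represented as ℕ → ℕ, only values on [n] matter):
-- weakly decreasing on [n], with all values in [k] (positive, at most k).
record IsPartition (n k : ℕ) (λ' : ℕ → ℕ) : Set where
  field
    parts-range : ∀ i → i ∈[ n ] → λ' i ∈[ k ]
    decreasing  : ∀ i j → i ∈[ n ] → j ∈[ n ] → i ≤ j → λ' j ≤ λ' i

τ : ℕ → ℕ → (ℕ → ℕ) → (ℕ → ℕ)
τ n k λ' i = γ k (λ' (γ n i))

t : ℕ → ℕ → ℕ → ℕ
t m r s with s <? r
... | yes _ = s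
... | no _ with s ≤? m + r ∸ 1
...   | yes _ = r
...   | no _ = s + 1 ∸ m

tilde : ℕ → (ℕ → ℕ) → (ℕ → ℕ)
tilde m μ i = t m i (μ i)

module Submission where

-- Write m = 1 + n.  For fixed r the map s ↦ t(r,s) is
-- the identity below r, constant r on the window [r, r+n], and the shift
-- s ↦ s - n above it.  Every statement follows from knowing which of these
-- three regions s lies in:
--   * part (a) holds region by region, since t(r,s) is s, r, or s - n;
--   * the central lemma 't-reflect' says that complementation respects t:
--     if x + r = N and y + s = N + n then t(x,y) + t(r,s) = N.  The
--     hypotheses make (x,y) lie in the region "opposite" to (r,s) (below
--     ↔ above, window ↔ window), so the lemma is a small computation in
--     each case, the "above" case being the "below" case with the roles of
--     (r,s) and (x,y) exchanged;
--   * γ_n is complementation with respect to n + 1, so parts (b) and (c)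
--     are 't-reflect' applied to (γ_ℓ r, γ_K s, r, s) and (i, γ_K s, γ_ℓ i, s)
--     respectively, where K = ℓ + m - 1 and s = μ(γ_ℓ i) in part (c).
-- All arithmetic is kept additive, avoiding truncated subtraction.

open import Defs
open import Data.Nat using (ℕ; suc; _+_; _∸_; _≤_; _<_; _>_)
open import Data.Nat.Properties
open import Data.Product using (_×_; _,_; proj₂)
open import Function.Bundles using (_⇔_; mk⇔)
open import Relation.Nullary using (¬_; yes; no)
open import Relation.Nullary.Negation using (contradiction)
open import Relation.Binary.PropositionalEquality
  using (_≡_; refl; sym; trans; cong; cong₂; subst; module ≡-Reasoning)

⇔-true : ∀ {a b} {A : Set a} {B : Set b} → A → B → A ⇔ B
⇔-true a b = mk⇔ (λ _ → b) (λ _ → a)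

⇔-false : ∀ {a b} {A : Set a} {B : Set b} → ¬ A → ¬ B → A ⇔ B
⇔-false ¬a ¬b = mk⇔ (λ a → contradiction a ¬a) (λ b → contradiction b ¬b)

≤-by-balance : ∀ {a b c d} → a + c ≡ b + d → c ≤ d → b ≤ a
≤-by-balance {a} {b} {c} eq c≤d =
  +-cancelʳ-≤ c b a (subst (b + c ≤_) (sym eq) (+-monoʳ-≤ b c≤d))

<-by-balance : ∀ {a b c d} → a + c ≡ b + d → c < d → b < a
<-by-balance {a} {b} {c} eq c<d =
  +-cancelʳ-< c b a (subst (b + c <_) (sym eq) (+-monoʳ-< b c<d))

γ-+ : ∀ {n i} → i ≤ suc n → γ n i + i ≡ suc n
γ-+ = m∸n+n≡m

γ-unique : ∀ {n a b} → a + b ≡ suc n → γ n b ≡ a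
γ-unique {b = b} eq = trans (cong (_∸ b) (sym eq)) (m+n∸n≡m _ b)

γ-∈ : ∀ {n i} → i ∈[ n ] → γ n i ∈[ n ]
γ-∈ {n} {suc i} (_ , i<n) = m+n≤o⇒m≤o∸n 1 i<n , m∸n≤m n i

data Region (n r s : ℕ) : Set where
  below   : s < r → Region n r s
  window  : r ≤ s → s ≤ n + r → Region n r s
  above   : n + r < s → Region n r s

region : ∀ n r s → Region n r s
region n r s with s <? r | s ≤? n + r
... | yes s<r | _      = below s<r
... | no  s≮r | yes s≤ = window (≮⇒≥ s≮r) s≤
... | no  _   | no  s≰ = above (≰⇒> s≰)

-- The value of t in each region (note that (1 + n) + r ∸ 1 is n + r).
t-below : ∀ {n r s} → s < r → t (suc n) r s ≡ s
t-below {n} {r} {s} s<r with s <? r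
... | yes _   = refl
... | no  s≮r = contradiction s<r s≮r

t-window : ∀ {n r s} → r ≤ s → s ≤ n + r → t (suc n) r s ≡ r
t-window {n} {r} {s} r≤s s≤ with s <? r
... | yes s<r = contradiction r≤s (<⇒≱ s<r)
... | no  _ with s ≤? n + r
...   | yes _  = refl
...   | no  s≰ = contradiction s≤ s≰

t-above : ∀ {n r s} → n + r < s → t (suc n) r s + n ≡ s
t-above {n} {r} {s} n+r<s with s <? r
... | yes s<r = contradiction s<r (<-asym (≤-<-trans (m≤n+m r n) n+r<s))
... | no  _ with s ≤? n + r
...   | yes s≤ = contradiction n+r<s (≤⇒≯ s≤)
...   | no  _  = begin
        s + 1 ∸ suc n + n ≡⟨ cong (λ z → z ∸ suc n + n) (+-comm s 1) ⟩
        s ∸ n + n         ≡⟨ m∸n+n≡m (≤-trans (m≤m+n n r) (<⇒≤ n+r<s)) ⟩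
        s                 ∎
  where open ≡-Reasoning

t-above-> : ∀ {n r s} → n + r < s → r < t (suc n) r s
t-above-> {n} {r} {s} n+r<s = +-cancelˡ-< n r _
  (subst (n + r <_) (trans (sym (t-above {n} {r} n+r<s)) (+-comm _ n)) n+r<s)

t-compare : ∀ n r s →
  ((t (suc n) r s < r) ⇔ (s < r)) × ((t (suc n) r s > r) ⇔ (s > n + r))
t-compare n r s with region n r s
... | below s<r rewrite t-below {n} s<r =
  ⇔-true s<r s<r
  , ⇔-false (<-asym s<r) (λ n+r<s → <-asym s<r (≤-<-trans (m≤n+m r n) n+r<s))
... | window r≤s s≤ rewrite t-window {n} r≤s s≤ =
  ⇔-false (<-irrefl refl) (≤⇒≯ r≤s) , ⇔-false (<-irrefl refl) (≤⇒≯ s≤)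
... | above n+r<s =
  ⇔-false (<⇒≯ (t-above-> {n} {r} n+r<s)) (<⇒≯ (≤-<-trans (m≤n+m r n) n+r<s))
  , ⇔-true (t-above-> {n} {r} n+r<s) n+r<s

+-regroup-inner : ∀ x r n → x + r + n ≡ x + (n + r)
+-regroup-inner x r n = trans (+-assoc x r n) (cong (x +_) (+-comm r n))

+-regroup-front : ∀ x r n → x + r + n ≡ n + x + r
+-regroup-front x r n = trans (+-comm (x + r) n) (sym (+-assoc n x r))

-- Reflection, case s < r: then (x,y) lies above its window.
t-reflect-below : ∀ n {x y r s} → s < r → y + s ≡ x + r + n →
  t (suc n) x y + t (suc n) r s ≡ x + r
t-reflect-below n {x} {y} {r} {s} s<r eq rewrite t-below {n} s<r =
  +-cancelʳ-≡ n _ _ (begin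
    t' + s + n  ≡⟨ +-assoc t' s n ⟩
    t' + (s + n) ≡⟨ cong (t' +_) (+-comm s n) ⟩
    t' + (n + s) ≡⟨ sym (+-assoc t' n s) ⟩
    t' + n + s  ≡⟨ cong (_+ s) (t-above {n} {x} n+x<y) ⟩
    y + s       ≡⟨ eq ⟩
    x + r + n   ∎)
  where
  open ≡-Reasoning
  t' = t (suc n) x y
  n+x<y : n + x < y
  n+x<y = <-by-balance (trans eq (+-regroup-front x r n)) s<r

t-reflect : ∀ n {N} x y r s → x + r ≡ N → y + s ≡ N + n →
  t (suc n) x y + t (suc n) r s ≡ N
t-reflect n x y r s refl eq with region n r s
... | below s<r = t-reflect-below n s<r eq
... | window r≤s s≤ = cong₂ _+_ (t-window x≤y y≤) (t-window r≤s s≤)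
  where
  x≤y : x ≤ y
  x≤y = ≤-by-balance (trans eq (+-regroup-inner x r n)) s≤
  y≤ : y ≤ n + x
  y≤ = ≤-by-balance (trans (sym (+-regroup-front x r n)) (sym eq)) r≤s
... | above n+r<s = begin
  t (suc n) x y + t (suc n) r s ≡⟨ +-comm _ (t (suc n) r s) ⟩
  t (suc n) r s + t (suc n) x y ≡⟨ t-reflect-below n y<x swapped ⟩
  r + x                         ≡⟨ +-comm r x ⟩
  x + r                         ∎
  where
  open ≡-Reasoning
  y<x : y < x
  y<x = <-by-balance (sym (trans eq (+-regroup-inner x r n))) n+r<s
  swapped : s + y ≡ r + x + n
  swapped = trans (+-comm s y) (trans eq (cong (_+ n) (+-comm x r)))

window-end : ∀ r n → r + suc n ∸ 1 ≡ n + r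
window-end r n = trans (cong (_∸ 1) (+-suc r n)) (+-comm r n)

γ-K-+ : ∀ ℓ n {s} → s ≤ ℓ + suc n ∸ 1 → γ (ℓ + suc n ∸ 1) s + s ≡ suc ℓ + n
γ-K-+ ℓ n s≤K =
  trans (γ-+ (≤-trans s≤K (n≤1+n _))) (cong (λ z → suc (z ∸ 1)) (+-suc ℓ n))

mainTheorem3 : (ℓ m : ℕ) → 1 ≤ ℓ → 1 ≤ m →
    (∀ r s → r ∈[ ℓ ] → s ∈[ ℓ + m ∸ 1 ] →
        ((t m r s < r) ⇔ (s < r)) × ((t m r s > r) ⇔ (s > r + m ∸ 1)))
    × (∀ r s → r ∈[ ℓ ] → s ∈[ ℓ + m ∸ 1 ] →
        t m (γ ℓ r) (γ (ℓ + m ∸ 1) s) ≡ γ ℓ (t m r s))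
    × (∀ μ → IsPartition ℓ (ℓ + m ∸ 1) μ → ∀ i → i ∈[ ℓ ] →
        γ ℓ (tilde m (τ ℓ (ℓ + m ∸ 1) μ) i) ≡ tilde m μ (γ ℓ i))
mainTheorem3 ℓ (suc n) _ _ = partA , partB , partC
  where
  partA : ∀ r s → r ∈[ ℓ ] → s ∈[ ℓ + suc n ∸ 1 ] →
    ((t (suc n) r s < r) ⇔ (s < r)) × ((t (suc n) r s > r) ⇔ (s > r + suc n ∸ 1))
  partA r s _ _ =
    subst (λ w → ((t (suc n) r s < r) ⇔ (s < r)) × ((t (suc n) r s > r) ⇔ (s > w)))
    (sym (window-end r n)) (t-compare n r s)

  partB : ∀ r s → r ∈[ ℓ ] → s ∈[ ℓ + suc n ∸ 1 ] →
    t (suc n) (γ ℓ r) (γ (ℓ + suc n ∸ 1) s) ≡ γ ℓ (t (suc n) r s)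
  partB r s (_ , r≤ℓ) (_ , s≤K) = sym (γ-unique
    (t-reflect n (γ ℓ r) (γ (ℓ + suc n ∸ 1) s) r s
      (γ-+ (≤-trans r≤ℓ (n≤1+n ℓ))) (γ-K-+ ℓ n s≤K)))

  -- (c): apply it to (i, γ_K (μ (γ_ℓ i))) and (γ_ℓ i, μ (γ_ℓ i)); only the
  -- range condition on μ is needed.
  partC : ∀ μ → IsPartition ℓ (ℓ + suc n ∸ 1) μ → ∀ i → i ∈[ ℓ ] →
    γ ℓ (tilde (suc n) (τ ℓ (ℓ + suc n ∸ 1) μ) i) ≡ tilde (suc n) μ (γ ℓ i)
  partC μ μ-part i i∈ = γ-unique (trans (+-comm (tilde (suc n) μ (γ ℓ i)) _)
    (t-reflect n i _ (γ ℓ i) (μ (γ ℓ i)) i+γi (γ-K-+ ℓ n s≤K)))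
    where
    i+γi : i + γ ℓ i ≡ suc ℓ
    i+γi = trans (+-comm i _) (γ-+ (≤-trans (proj₂ i∈) (n≤1+n ℓ)))
    s≤K : μ (γ ℓ i) ≤ ℓ + suc n ∸ 1
    s≤K = proj₂ (IsPartition.parts-range μ-part (γ ℓ i) (γ-∈ i∈))
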